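{- For every positive integer $n$, $|B_n(123,132,213)|=1$.
   Context: A permutation $\sigma\in S_n$ is written as $\sigma(1)\cdots\sigma(n)$. An index $i\in[n-1]$ is an ascent if $\sigma(i)<\sigma(i+1)$ and a descent if $\sigma(i)>\sigma(i+1)$. A ballot permutation is a permutation such that every prefix $\sigma(1)\cdots\sigma(p)$ has at least as many ascents as descents. $\sigma$ contains a pattern $\pi\in S_k$ if some subsequence $\sigma(c_1)\cdots\sigma(c_k)$ with $c_1<\dots<c_k$ is order-isomorphic to $\pi$, and avoids $\pi$ otherwise. $B_n(\pi_1,\dots,\pi_m)$ denotes the set of ballot permutations of length $n$ avoiding all of $\pi_1,\dots,\pi_m$. -}

module Defs where

open import Data.Nat using (ℕ; zero; suc; _+_; _≤_; _<_; _<ᵇ_)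
open import Data.Nat.Properties using (<-trans; n<1+n; <⇒≤)
open import Data.Bool using (Bool; true; false; if_then_else_)
open import Data.Fin using (Fin; toℕ; fromℕ<)
open import Data.Product using (Σ; ∃; _×_; _,_)
open import Function.Definitions using (Injective)
open import Function.Bundles using (_⇔_)
open import Relation.Binary.PropositionalEquality using (_≡_)
open import Relation.Nullary using (¬_)

-- A permutation σ ∈ S_n, positions and values 0-indexed as Fin n:
-- σ(1)⋯σ(n) of the paper corresponds to fun σ 0, …, fun σ (n-1).
record Perm (n : ℕ) : Set where
  constructor perm
  field
    fun : Fin n → Fin n
    inj : Injective _≡_ _≡_ fun
open Perm public

_≗ₚ_ : ∀ {n} → Perm n → Perm n → Set
σ ≗ₚ τ = ∀ i → fun σ i ≡ fun τ i

val : ∀ {n} → Perm n → (i : ℕ) → i < n → ℕ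
val σ i p = toℕ (fun σ (fromℕ< p))

-- Number of ascents (resp. descents) at positions i with i+1 < m,
-- i.e. the ascents/descents of the prefix σ(0)…σ(m-1), for m ≤ n.
ascDes : ∀ {n} → Perm n → (m : ℕ) → m ≤ n → ℕ × ℕ
ascDes σ zero _ = 0 , 0
ascDes σ (suc zero) _ = 0 , 0
ascDes {n} σ (suc (suc i)) p with ascDes σ (suc i) (<⇒≤ p)
... | a , d =
  let x = val σ i (<-trans (n<1+n i) p)
      y = val σ (suc i) p
  in if x <ᵇ y then (suc a , d) else (a , suc d)

IsBallot : ∀ {n} → Perm n → Set
IsBallot {n} σ = ∀ (m : ℕ) (p : m ≤ n) →
  let (a , d) = ascDes σ m p in d ≤ a

Contains : ∀ {n k} → Perm n → Perm k → Set
Contains {n} {k} σ π =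
  Σ (Fin k → Fin n) λ c →
    (∀ a b → toℕ a < toℕ b → toℕ (c a) < toℕ (c b)) ×
    (∀ a b → (toℕ (fun σ (c a)) < toℕ (fun σ (c b))) ⇔ (toℕ (fun π a) < toℕ (fun π b)))

Avoids : ∀ {n k} → Perm n → Perm k → Set
Avoids σ π = ¬ Contains σ π

p123 p132 p213 : Perm 3
p123 = perm f i
  where
  f : Fin 3 → Fin 3
  f Fin.zero = Fin.zero
  f (Fin.suc Fin.zero) = Fin.suc Fin.zero
  f (Fin.suc (Fin.suc Fin.zero)) = Fin.suc (Fin.suc Fin.zero)
  i : Injective _≡_ _≡_ f
  i {Fin.zero} {Fin.zero} _ = _≡_.refl
  i {Fin.suc Fin.zero} {Fin.suc Fin.zero} _ = _≡_.refl
  i {Fin.suc (Fin.suc Fin.zero)} {Fin.suc (Fin.suc Fin.zero)} _ = _≡_.refl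
  i {Fin.zero} {Fin.suc Fin.zero} ()
  i {Fin.zero} {Fin.suc (Fin.suc Fin.zero)} ()
  i {Fin.suc Fin.zero} {Fin.zero} ()
  i {Fin.suc Fin.zero} {Fin.suc (Fin.suc Fin.zero)} ()
  i {Fin.suc (Fin.suc Fin.zero)} {Fin.zero} ()
  i {Fin.suc (Fin.suc Fin.zero)} {Fin.suc Fin.zero} ()
p132 = perm f i
  where
  f : Fin 3 → Fin 3
  f Fin.zero = Fin.zero
  f (Fin.suc Fin.zero) = Fin.suc (Fin.suc Fin.zero)
  f (Fin.suc (Fin.suc Fin.zero)) = Fin.suc Fin.zero
  i : Injective _≡_ _≡_ f
  i {Fin.zero} {Fin.zero} _ = _≡_.refl
  i {Fin.suc Fin.zero} {Fin.suc Fin.zero} _ = _≡_.refl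
  i {Fin.suc (Fin.suc Fin.zero)} {Fin.suc (Fin.suc Fin.zero)} _ = _≡_.refl
  i {Fin.zero} {Fin.suc Fin.zero} ()
  i {Fin.zero} {Fin.suc (Fin.suc Fin.zero)} ()
  i {Fin.suc Fin.zero} {Fin.zero} ()
  i {Fin.suc Fin.zero} {Fin.suc (Fin.suc Fin.zero)} ()
  i {Fin.suc (Fin.suc Fin.zero)} {Fin.zero} ()
  i {Fin.suc (Fin.suc Fin.zero)} {Fin.suc Fin.zero} ()
p213 = perm f i
  where
  f : Fin 3 → Fin 3
  f Fin.zero = Fin.suc Fin.zero
  f (Fin.suc Fin.zero) = Fin.zero
  f (Fin.suc (Fin.suc Fin.zero)) = Fin.suc (Fin.suc Fin.zero)
  i : Injective _≡_ _≡_ f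
  i {Fin.zero} {Fin.zero} _ = _≡_.refl
  i {Fin.suc Fin.zero} {Fin.suc Fin.zero} _ = _≡_.refl
  i {Fin.suc (Fin.suc Fin.zero)} {Fin.suc (Fin.suc Fin.zero)} _ = _≡_.refl
  i {Fin.zero} {Fin.suc Fin.zero} ()
  i {Fin.zero} {Fin.suc (Fin.suc Fin.zero)} ()
  i {Fin.suc Fin.zero} {Fin.zero} ()
  i {Fin.suc Fin.zero} {Fin.suc (Fin.suc Fin.zero)} ()
  i {Fin.suc (Fin.suc Fin.zero)} {Fin.zero} ()
  i {Fin.suc (Fin.suc Fin.zero)} {Fin.suc Fin.zero} ()

InB : ∀ {n} → Perm n → Set
InB σ = IsBallot σ × Avoids σ p123 × Avoids σ p132 × Avoids σ p213

-- Avoiding 123 and 132 means that every entry has at most one larger entry to its right.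
-- Hence an ascent at i is followed by a descent, and every entry after i + 1 is smaller
-- than σ(i).  Ballot permutations start with an ascent, so the ascents and descents of
-- such a permutation alternate, starting with an ascent.  The first two entries are then
-- larger than all later ones, which forces σ(0) = n - 2 and σ(1) = n - 1; repeating the
-- argument on the remaining entries shows that σ = (n-2)(n-1)(n-4)(n-3)⋯ (0-indexed).
-- Conversely this permutation is ballot, and since all its ascents are between adjacent
-- positions it avoids 123, 132 and 213.
module Submission where

open import Defs
open import Data.Nat
open import Data.Nat.Properties
open import Data.Bool using (true; false)
open import Data.Fin using (Fin; toℕ; fromℕ<)
open import Data.Fin.Patterns using (0F; 1F; 2F)
open import Data.Fin.Properties using (toℕ-injective; toℕ<n; toℕ-fromℕ<; fromℕ<-toℕ; injective⇒≤)
open import Data.Vec using ([]; _∷_; lookup)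
open import Data.Product using (Σ; _×_; _,_; proj₁; proj₂; map₂)
open import Data.Sum using (_⊎_; inj₁; inj₂; map₁)
open import Function.Base using (_∘_)
open import Function.Bundles using (mk⇔; Equivalence)
open import Relation.Binary.Definitions using (tri<; tri≈; tri>)
open import Relation.Binary.PropositionalEquality
open import Relation.Nullary using (¬_; yes; no; contradiction)

double : ℕ → ℕ
double zero = zero
double (suc k) = suc (suc (double k))

data Half : ℕ → Set where
  even : ∀ k → Half (double k)
  odd  : ∀ k → Half (suc (double k))

half : ∀ m → Half m
half zero = even zero
half (suc m) with half m
... | even k = odd k
... | odd k = even (suc k)

-- Properties of a sequence t on the positions [0, n).  Sequences ℕ → ℕ are used instead of
-- permutations so that the tail of t is simply λ i → t (2 + i).
ValuesBelow : ℕ → ℕ → (ℕ → ℕ) → Set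
ValuesBelow n b t = ∀ {i} → i < n → t i < b

InjectiveBelow : ℕ → (ℕ → ℕ) → Set
InjectiveBelow n t = ∀ {i j} → i < n → j < n → t i ≡ t j → i ≡ j

AtMostOneLargerAfter : ℕ → (ℕ → ℕ) → Set
AtMostOneLargerAfter n t = ∀ {i j k} → i < j → j < k → k < n → t i < t j → ¬ t i < t k

AscentsAdjacent : ℕ → (ℕ → ℕ) → Set
AscentsAdjacent n t = ∀ {i j} → i < j → j < n → t i < t j → j ≡ suc i

NoDoubleAscent : ℕ → (ℕ → ℕ) → Set
NoDoubleAscent n t = ∀ {i} → suc (suc i) < n → t i < t (suc i) → ¬ t (suc i) < t (suc (suc i))

EvenAscents : ℕ → (ℕ → ℕ) → Set
EvenAscents n t = ∀ k → suc (double k) < n → t (double k) < t (suc (double k))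

injectiveBelow⇒≤ : ∀ {m b t} → ValuesBelow m b t → InjectiveBelow m t → m ≤ b
injectiveBelow⇒≤ {m} {b} {t} below injective = injective⇒≤ {f = f} f-injective
  where
  f : Fin m → Fin b
  f x = fromℕ< (below (toℕ<n x))

  f-injective : ∀ {x y} → f x ≡ f y → x ≡ y
  f-injective {x} {y} fx≡fy = toℕ-injective (injective (toℕ<n x) (toℕ<n y) (begin
    t (toℕ x)   ≡⟨ toℕ-fromℕ< _ ⟨
    toℕ (f x)   ≡⟨ cong toℕ fx≡fy ⟩
    toℕ (f y)   ≡⟨ toℕ-fromℕ< _ ⟩
    t (toℕ y)   ∎))
    where open ≡-Reasoning

ascentsAdjacent⇒noDoubleAscent : ∀ {n t} → AscentsAdjacent n t → NoDoubleAscent n t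
ascentsAdjacent⇒noDoubleAscent adjacent {i} i+2<n up up′ =
  1+n≢n (adjacent (<-trans (n<1+n i) (n<1+n (suc i))) i+2<n (<-trans up up′))

atMostOneLargerAfter⇒noDoubleAscent : ∀ {n t} → AtMostOneLargerAfter n t → NoDoubleAscent n t
atMostOneLargerAfter⇒noDoubleAscent atMostOne {i} i+2<n up up′ =
  atMostOne (n<1+n i) (n<1+n (suc i)) i+2<n up (<-trans up up′)

ascent⇒laterSmaller : ∀ {n t} → InjectiveBelow n t → AtMostOneLargerAfter n t →
  ∀ {i p} → t i < t (suc i) → suc i < p → p < n → t p < t i
ascent⇒laterSmaller {t = t} injective atMostOne {i} {p} up i+1<p p<n with <-cmp (t p) (t i)
... | tri< tp<ti _ _ = tp<ti
... | tri≈ _ tp≡ti _ = contradiction (injective p<n (<-trans i<p p<n) tp≡ti) (>⇒≢ i<p)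
  where
  i<p : i < p
  i<p = <-trans (n<1+n i) i+1<p
... | tri> _ _ ti<tp = contradiction ti<tp (atMostOne (n<1+n i) i+1<p p<n up)

ρ : ℕ → ℕ → ℕ
ρ (suc (suc n)) zero = n
ρ (suc (suc n)) (suc zero) = suc n
ρ (suc (suc n)) (suc (suc i)) = ρ n i
ρ _ _ = zero

ρ-< : ∀ {n} → ValuesBelow n n (ρ n)
ρ-< {suc zero} {zero} _ = z<s
ρ-< {suc zero} {suc i} (s≤s ())
ρ-< {suc (suc n)} {zero} _ = <-trans (n<1+n n) (n<1+n (suc n))
ρ-< {suc (suc n)} {suc zero} _ = n<1+n (suc n)
ρ-< {suc (suc n)} {suc (suc i)} (s≤s (s≤s i<n)) = <-trans (ρ-< i<n) (<-trans (n<1+n n) (n<1+n (suc n)))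

ρ-cmp : ∀ {n i j} → i < j → j < n → (ρ n i < ρ n j × j ≡ suc i) ⊎ ρ n j < ρ n i
ρ-cmp {suc (suc n)} {zero} {suc zero} _ _ = inj₁ (n<1+n n , refl)
ρ-cmp {suc (suc n)} {zero} {suc (suc j)} _ (s≤s (s≤s j<n)) = inj₂ (ρ-< j<n)
ρ-cmp {suc (suc n)} {suc zero} {suc (suc j)} _ (s≤s (s≤s j<n)) = inj₂ (<-trans (ρ-< j<n) (n<1+n n))
ρ-cmp {suc (suc n)} {suc (suc i)} {suc (suc j)} (s≤s (s≤s i<j)) (s≤s (s≤s j<n)) =
  map₁ (map₂ (cong (suc ∘ suc))) (ρ-cmp i<j j<n)
ρ-cmp {suc (suc n)} {suc zero} {suc zero} (s≤s ()) _
ρ-cmp {suc zero} {zero} {suc zero} _ (s≤s ())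

ρ-≢ : ∀ {n i j} → i < j → j < n → ρ n i ≢ ρ n j
ρ-≢ i<j j<n with ρ-cmp i<j j<n
... | inj₁ (ρi<ρj , _) = <⇒≢ ρi<ρj
... | inj₂ ρj<ρi = >⇒≢ ρj<ρi

ρ-injective : ∀ {n} → InjectiveBelow n (ρ n)
ρ-injective {i = i} {j} i<n j<n ρi≡ρj with <-cmp i j
... | tri< i<j _ _ = contradiction ρi≡ρj (ρ-≢ i<j j<n)
... | tri≈ _ i≡j _ = i≡j
... | tri> _ _ j<i = contradiction (sym ρi≡ρj) (ρ-≢ j<i i<n)

ρ-ascentsAdjacent : ∀ {n} → AscentsAdjacent n (ρ n)
ρ-ascentsAdjacent i<j j<n ρi<ρj with ρ-cmp i<j j<n
... | inj₁ (_ , j≡1+i) = j≡1+i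
... | inj₂ ρj<ρi = contradiction ρi<ρj (<-asym ρj<ρi)

ρ-evenAscents : ∀ {n} → EvenAscents n (ρ n)
ρ-evenAscents {suc (suc n)} zero _ = n<1+n n
ρ-evenAscents {suc (suc n)} (suc k) (s≤s (s≤s k<n)) = ρ-evenAscents k k<n
ρ-evenAscents {suc zero} zero (s≤s ())

evenAscents⇒≡ρ : ∀ {n t} → ValuesBelow n n t → InjectiveBelow n t → AtMostOneLargerAfter n t →
  EvenAscents n t → ∀ {i} → i < n → t i ≡ ρ n i
evenAscents⇒≡ρ {suc zero} below _ _ _ {zero} _ = n<1⇒n≡0 (below z<s)
evenAscents⇒≡ρ {suc zero} _ _ _ _ {suc i} (s≤s ())
evenAscents⇒≡ρ {suc (suc m)} {t} below injective atMostOne ascents = pinned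
  where
  tail : ℕ → ℕ
  tail i = t (suc (suc i))

  t0<t1 : t 0 < t 1
  t0<t1 = ascents 0 (s≤s (s≤s z≤n))

  tail<t0 : ValuesBelow m (t 0) tail
  tail<t0 i<m = ascent⇒laterSmaller injective atMostOne t0<t1 (s≤s (s≤s z≤n)) (s≤s (s≤s i<m))

  tail-injective : InjectiveBelow m tail
  tail-injective i<m j<m tail≡ = suc-injective (suc-injective (injective (s≤s (s≤s i<m)) (s≤s (s≤s j<m)) tail≡))

  t0≡m : t 0 ≡ m
  t0≡m = ≤-antisym (≤-pred (<-≤-trans t0<t1 (≤-pred (below (s≤s (s≤s z≤n))))))
                   (injectiveBelow⇒≤ tail<t0 tail-injective)

  t1≡1+m : t 1 ≡ suc m
  t1≡1+m = ≤-antisym (≤-pred (below (s≤s (s≤s z≤n)))) (subst (_< t 1) t0≡m t0<t1)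

  tail≡ρ : ∀ {i} → i < m → tail i ≡ ρ m i
  tail≡ρ = evenAscents⇒≡ρ (λ i<m → subst (tail _ <_) t0≡m (tail<t0 i<m)) tail-injective
    (λ i<j j<k k<m → atMostOne (s≤s (s≤s i<j)) (s≤s (s≤s j<k)) (s≤s (s≤s k<m)))
    (λ k k<m → ascents (suc k) (s≤s (s≤s k<m)))

  pinned : ∀ {i} → i < suc (suc m) → t i ≡ ρ (suc (suc m)) i
  pinned {zero} _ = t0≡m
  pinned {suc zero} _ = t1≡1+m
  pinned {suc (suc i)} (s≤s (s≤s i<m)) = tail≡ρ i<m

-- σ(i) as a total function, extended by 0 outside [0, n).
value : ∀ {n} → Perm n → ℕ → ℕ
value {n} σ i with i <? n
... | yes i<n = val σ i i<n
... | no _ = 0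

module _ {n} (σ : Perm n) where

  val≡value : ∀ {i} (i<n : i < n) → val σ i i<n ≡ value σ i
  val≡value {i} i<n with i <? n
  ... | yes i<n′ = cong (val σ i) (<-irrelevant i<n i<n′)
  ... | no i≮n = contradiction i<n i≮n

  value-toℕ : ∀ x → value σ (toℕ x) ≡ toℕ (fun σ x)
  value-toℕ x = begin
    value σ (toℕ x)                        ≡⟨ val≡value (toℕ<n x) ⟨
    toℕ (fun σ (fromℕ< (toℕ<n x)))         ≡⟨ cong (toℕ ∘ fun σ) (fromℕ<-toℕ x (toℕ<n x)) ⟩
    toℕ (fun σ x)                          ∎
    where open ≡-Reasoning

  value-< : ValuesBelow n n (value σ)
  value-< i<n = subst (_< n) (val≡value i<n) (toℕ<n _)

  value-injective : InjectiveBelow n (value σ)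
  value-injective {i} {j} i<n j<n value≡ = begin
    i                     ≡⟨ toℕ-fromℕ< i<n ⟨
    toℕ (fromℕ< i<n)      ≡⟨ cong toℕ (inj σ (toℕ-injective fun≡)) ⟩
    toℕ (fromℕ< j<n)      ≡⟨ toℕ-fromℕ< j<n ⟩
    j                     ∎
    where
    open ≡-Reasoning
    fun≡ : val σ i i<n ≡ val σ j j<n
    fun≡ = trans (val≡value i<n) (trans value≡ (sym (val≡value j<n)))

  module _ {i a d} (p : suc (suc i) ≤ n) (prefix : ascDes σ (suc i) (<⇒≤ p) ≡ (a , d)) where

    ascDes-ascent : value σ i < value σ (suc i) → ascDes σ (suc (suc i)) p ≡ (suc a , d)
    ascDes-ascent up rewrite prefix | val≡value p | val≡value (<-trans (n<1+n i) p)
      with value σ i <ᵇ value σ (suc i) | <⇒<ᵇ up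
    ... | true | _ = refl

    ascDes-descent : ¬ value σ i < value σ (suc i) → ascDes σ (suc (suc i)) p ≡ (a , suc d)
    ascDes-descent down rewrite prefix | val≡value p | val≡value (<-trans (n<1+n i) p)
      with value σ i <ᵇ value σ (suc i) | <ᵇ⇒< (value σ i) (value σ (suc i))
    ... | true | up = contradiction (up _) down
    ... | false | _ = refl

  ballot-at : IsBallot σ → ∀ {m p a d} → ascDes σ m p ≡ (a , d) → d ≤ a
  ballot-at ballot {m} {p} prefix = subst (λ (a , d) → d ≤ a) prefix (ballot m p)

  module _ (noDoubleAscent : NoDoubleAscent n (value σ)) where

    -- `up` may use that the prefix of length 2k + 1 is balanced: this is how ballotness forces the ascents.
    ascDes-alternating :
      (∀ k (p : suc (suc (double k)) ≤ n) → ascDes σ (suc (double k)) (<⇒≤ p) ≡ (k , k) →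
        value σ (double k) < value σ (suc (double k))) →
      ∀ k (p : suc (double k) ≤ n) → ascDes σ (suc (double k)) p ≡ (k , k)
    ascDes-alternating up zero p = refl
    ascDes-alternating up (suc k) p =
      ascDes-descent p (ascDes-ascent (<⇒≤ p) prefix up-k) (noDoubleAscent p up-k)
      where
      prefix : ascDes σ (suc (double k)) (<⇒≤ (<⇒≤ p)) ≡ (k , k)
      prefix = ascDes-alternating up k (<⇒≤ (<⇒≤ p))

      up-k : value σ (double k) < value σ (suc (double k))
      up-k = up k (<⇒≤ p) prefix

    ballot⇒evenAscents : IsBallot σ → EvenAscents n (value σ)
    ballot⇒evenAscents ballot k p = forced k p (ascDes-alternating forced k (<⇒≤ p))
      where
      forced : ∀ k (p : suc (suc (double k)) ≤ n) → ascDes σ (suc (double k)) (<⇒≤ p) ≡ (k , k) →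
        value σ (double k) < value σ (suc (double k))
      forced k p prefix with value σ (double k) <? value σ (suc (double k))
      ... | yes up = up
      ... | no down = contradiction (ballot-at ballot (ascDes-descent p prefix down)) 1+n≰n

    evenAscents⇒ballot : EvenAscents n (value σ) → IsBallot σ
    evenAscents⇒ballot ascents m = prefixBallot (half m)
      where
      alternating : ∀ k (p : suc (double k) ≤ n) → ascDes σ (suc (double k)) p ≡ (k , k)
      alternating = ascDes-alternating (λ k p _ → ascents k p)

      balanced : ∀ {m p a d} → ascDes σ m p ≡ (a , d) → d ≤ a → proj₂ (ascDes σ m p) ≤ proj₁ (ascDes σ m p)
      balanced prefix d≤a = subst (λ (a , d) → d ≤ a) (sym prefix) d≤a

      prefixBallot : ∀ {m} → Half m → (p : m ≤ n) → proj₂ (ascDes σ m p) ≤ proj₁ (ascDes σ m p)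
      prefixBallot (even zero) p = z≤n
      prefixBallot (even (suc k)) p = balanced (ascDes-ascent p (alternating k (<⇒≤ p)) (ascents k p)) (n≤1+n k)
      prefixBallot (odd k) p = balanced {p = p} (alternating k p) ≤-refl

occurrence : ∀ {n k} (σ : Perm n) (π : Perm k) (c : Fin k → ℕ) (c<n : ∀ a → c a < n) →
  (∀ a b → toℕ a < toℕ b → c a < c b) →
  (∀ a b → toℕ (fun π a) < toℕ (fun π b) → value σ (c a) < value σ (c b)) → Contains σ π
occurrence {n} {k} σ π c c<n c-increasing preserve =
  position , position-increasing , λ a b → mk⇔ (reflect a b) (preserve′ a b)
  where
  position : Fin k → Fin n
  position a = fromℕ< (c<n a)

  position-increasing : ∀ a b → toℕ a < toℕ b → toℕ (position a) < toℕ (position b)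
  position-increasing a b a<b =
    subst₂ _<_ (sym (toℕ-fromℕ< (c<n a))) (sym (toℕ-fromℕ< (c<n b))) (c-increasing a b a<b)

  preserve′ : ∀ a b → toℕ (fun π a) < toℕ (fun π b) → toℕ (fun σ (position a)) < toℕ (fun σ (position b))
  preserve′ a b πa<πb = subst₂ _<_ (sym (val≡value σ (c<n a))) (sym (val≡value σ (c<n b))) (preserve a b πa<πb)

  reflect : ∀ a b → toℕ (fun σ (position a)) < toℕ (fun σ (position b)) → toℕ (fun π a) < toℕ (fun π b)
  reflect a b σa<σb with <-cmp (toℕ (fun π a)) (toℕ (fun π b))
  ... | tri< πa<πb _ _ = πa<πb
  ... | tri≈ _ πa≡πb _ rewrite inj π (toℕ-injective πa≡πb) = contradiction σa<σb (<-irrefl refl)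
  ... | tri> _ _ πb<πa = contradiction σa<σb (<-asym (preserve′ b a πb<πa))

increasing₃ : (w : Fin 3 → ℕ) → w 0F < w 1F → w 1F < w 2F → ∀ a b → toℕ a < toℕ b → w a < w b
increasing₃ w w0<w1 w1<w2 0F 1F _ = w0<w1
increasing₃ w w0<w1 w1<w2 0F 2F _ = <-trans w0<w1 w1<w2
increasing₃ w w0<w1 w1<w2 1F 2F _ = w1<w2
increasing₃ w _ _ (Fin.suc _) 1F (s<s ())
increasing₃ w _ _ (Fin.suc (Fin.suc _)) 2F (s<s (s<s ()))

-- For an involutive pattern π, the entries v must increase along π⁻¹ = π.
occurrence₃ : ∀ {n} (σ : Perm n) (π : Perm 3) → (∀ a → fun π (fun π a) ≡ a) →
  ∀ {i j k} → i < j → j < k → (k<n : k < n) →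
  let v = value σ ∘ lookup (i ∷ j ∷ k ∷ []) in
  v (fun π 0F) < v (fun π 1F) → v (fun π 1F) < v (fun π 2F) → Contains σ π
occurrence₃ {n} σ π involutive {i} {j} {k} i<j j<k k<n v₀<v₁ v₁<v₂ =
  occurrence σ π c c<n (increasing₃ c i<j j<k) preserve
  where
  c : Fin 3 → ℕ
  c = lookup (i ∷ j ∷ k ∷ [])

  c<n : ∀ a → c a < n
  c<n 0F = <-trans i<j (<-trans j<k k<n)
  c<n 1F = <-trans j<k k<n
  c<n 2F = k<n

  preserve : ∀ a b → toℕ (fun π a) < toℕ (fun π b) → value σ (c a) < value σ (c b)
  preserve a b πa<πb = subst₂ (λ a b → value σ (c a) < value σ (c b)) (involutive a) (involutive b)
    (increasing₃ (value σ ∘ c ∘ fun π) v₀<v₁ v₁<v₂ (fun π a) (fun π b) πa<πb)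

p123-involutive : ∀ a → fun p123 (fun p123 a) ≡ a
p123-involutive 0F = refl
p123-involutive 1F = refl
p123-involutive 2F = refl

p132-involutive : ∀ a → fun p132 (fun p132 a) ≡ a
p132-involutive 0F = refl
p132-involutive 1F = refl
p132-involutive 2F = refl

avoids⇒atMostOneLargerAfter : ∀ {n} (σ : Perm n) → Avoids σ p123 → Avoids σ p132 →
  AtMostOneLargerAfter n (value σ)
avoids⇒atMostOneLargerAfter σ avoid123 avoid132 {i} {j} {k} i<j j<k k<n vi<vj vi<vk
  with <-cmp (value σ j) (value σ k)
... | tri< vj<vk _ _ = avoid123 (occurrence₃ σ p123 p123-involutive i<j j<k k<n vi<vj vj<vk)
... | tri≈ _ vj≡vk _ = contradiction (value-injective σ (<-trans j<k k<n) k<n vj≡vk) (<⇒≢ j<k)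
... | tri> _ _ vk<vj = avoid132 (occurrence₃ σ p132 p132-involutive i<j j<k k<n vi<vk vk<vj)

ascentsAdjacent⇒avoids : ∀ {n} (σ : Perm n) → AscentsAdjacent n (value σ) →
  (π : Perm 3) → toℕ (fun π 0F) < toℕ (fun π 2F) → Avoids σ π
ascentsAdjacent⇒avoids σ adjacent π π0<π2 (c , c-increasing , order) =
  <-irrefl refl (<-≤-trans c1<c2 (subst (_≤ toℕ (c 1F)) (sym c2≡1+c0) c0<c1))
  where
  c0<c1 : toℕ (c 0F) < toℕ (c 1F)
  c0<c1 = c-increasing 0F 1F z<s

  c1<c2 : toℕ (c 1F) < toℕ (c 2F)
  c1<c2 = c-increasing 1F 2F (s<s z<s)

  c2≡1+c0 : toℕ (c 2F) ≡ suc (toℕ (c 0F))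
  c2≡1+c0 = adjacent (<-trans c0<c1 c1<c2) (toℕ<n (c 2F))
    (subst₂ _<_ (sym (value-toℕ σ (c 0F))) (sym (value-toℕ σ (c 2F))) (Equivalence.from (order 0F 2F) π0<π2))

ρ-perm : ∀ n → Perm n
ρ-perm n = perm (λ x → fromℕ< (ρ-< (toℕ<n x))) injective
  where
  injective : ∀ {x y} → fromℕ< (ρ-< (toℕ<n x)) ≡ fromℕ< (ρ-< (toℕ<n y)) → x ≡ y
  injective {x} {y} e = toℕ-injective (ρ-injective (toℕ<n x) (toℕ<n y)
    (trans (sym (toℕ-fromℕ< _)) (trans (cong toℕ e) (toℕ-fromℕ< _))))

value-ρ-perm : ∀ {n i} → i < n → value (ρ-perm n) i ≡ ρ n i
value-ρ-perm {n} {i} i<n = begin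
  value (ρ-perm n) i                        ≡⟨ val≡value (ρ-perm n) i<n ⟨
  toℕ (fromℕ< (ρ-< (toℕ<n (fromℕ< i<n))))   ≡⟨ toℕ-fromℕ< _ ⟩
  ρ n (toℕ (fromℕ< i<n))                    ≡⟨ cong (ρ n) (toℕ-fromℕ< i<n) ⟩
  ρ n i                                     ∎
  where open ≡-Reasoning

ρ-perm∈B : ∀ n → InB (ρ-perm n)
ρ-perm∈B n =
  evenAscents⇒ballot σ (ascentsAdjacent⇒noDoubleAscent adjacent) ascents ,
  ascentsAdjacent⇒avoids σ adjacent p123 (s≤s z≤n) ,
  ascentsAdjacent⇒avoids σ adjacent p132 (s≤s z≤n) ,
  ascentsAdjacent⇒avoids σ adjacent p213 (s≤s (s≤s z≤n))
  where
  σ : Perm n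
  σ = ρ-perm n

  adjacent : AscentsAdjacent n (value σ)
  adjacent i<j j<n vi<vj =
    ρ-ascentsAdjacent i<j j<n (subst₂ _<_ (value-ρ-perm (<-trans i<j j<n)) (value-ρ-perm j<n) vi<vj)

  ascents : EvenAscents n (value σ)
  ascents k p = subst₂ _<_ (sym (value-ρ-perm (<-trans (n<1+n _) p))) (sym (value-ρ-perm p)) (ρ-evenAscents k p)

value≡ρ : ∀ {n} (τ : Perm n) → IsBallot τ → Avoids τ p123 → Avoids τ p132 → ∀ {i} → i < n → value τ i ≡ ρ n i
value≡ρ {n} τ ballot avoid123 avoid132 =
  evenAscents⇒≡ρ (value-< τ) (value-injective τ) atMostOne
    (ballot⇒evenAscents τ (atMostOneLargerAfter⇒noDoubleAscent atMostOne) ballot)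
  where
  atMostOne : AtMostOneLargerAfter n (value τ)
  atMostOne = avoids⇒atMostOneLargerAfter τ avoid123 avoid132

corollary4p1 : (n : ℕ) → Σ (Perm (suc n)) (λ σ → InB σ × ((τ : Perm (suc n)) → InB τ → τ ≗ₚ σ))
corollary4p1 n = ρ-perm (suc n) , ρ-perm∈B (suc n) , unique
  where
  unique : (τ : Perm (suc n)) → InB τ → τ ≗ₚ ρ-perm (suc n)
  unique τ (ballot , avoid123 , avoid132 , _) x = toℕ-injective (begin
    toℕ (fun τ x)                     ≡⟨ value-toℕ τ x ⟨
    value τ (toℕ x)                   ≡⟨ value≡ρ τ ballot avoid123 avoid132 (toℕ<n x) ⟩
    ρ (suc n) (toℕ x)                 ≡⟨ value-ρ-perm (toℕ<n x) ⟨
    value (ρ-perm (suc n)) (toℕ x)    ≡⟨ value-toℕ (ρ-perm (suc n)) x ⟩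
    toℕ (fun (ρ-perm (suc n)) x)      ∎)
    where open ≡-Reasoning
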